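{- Let $k,n\in\mathbb{N}$ with $k>n$. Let $\overline{\sigma}^1=(1,2,\dots,k)$ and, for $j\in[k-1]$, let $\overline{\sigma}^{j+1}$ be obtained from $\overline{\sigma}^{j}$ by a circular shift to the right, i.e. $\overline{\sigma}^{j+1}=(\overline{\sigma}^j_k,\overline{\sigma}^j_1,\dots,\overline{\sigma}^j_{k-1})$. For $j\in[k]$ let $\sigma^j=(\overline{\sigma}^j_1,\dots,\overline{\sigma}^j_n)$ consist of the first $n$ entries of $\overline{\sigma}^j$. Then for every $y=(y_1,\dots,y_n)\in[k]^n$ with pairwise distinct entries there is $j\in[k]$ with $\mathrm{info}(\sigma^j,y)=\mathrm{no}$, i.e. $\sigma^j_i\ne y_i$ for all $i\in[n]$.
   Context: $[m]=\{1,\dots,m\}$. For $\sigma,y\in[k]^n$, $\mathrm{info}(\sigma,y)=\mathrm{yes}$ if there is $i\in[n]$ with $\sigma_i=y_i$, and $\mathrm{no}$ otherwise. -}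

module Defs where

open import Data.Nat using (ℕ; zero; suc; _≤_; _<_)
open import Data.Fin using (Fin; zero; suc; inject₁; inject≤; fromℕ)
open import Data.Nat.Properties using (<⇒≤)
open import Data.Product using (∃)
open import Relation.Binary.PropositionalEquality using (_≡_)
open import Relation.Nullary using (¬_)

-- Convention: [k] is represented by Fin k (value v : Fin k stands for toℕ v + 1),
-- and positions 1..n are represented by Fin n (0-indexed).

shiftRight : ∀ {m k} → (Fin (suc m) → Fin k) → (Fin (suc m) → Fin k)
shiftRight {m} a zero    = a (fromℕ m)
shiftRight {m} a (suc i) = a (inject₁ i)

-- σ̄^(j+1), indexed from 0: sbar 0 = (1,2,…,k) = identity, sbar (suc j) = shiftRight (sbar j).
sbar : ∀ m → ℕ → (Fin (suc m) → Fin (suc m))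
sbar m zero    = λ i → i
sbar m (suc j) = shiftRight (sbar m j)

sigma : ∀ {m n} → n ≤ suc m → ℕ → (Fin n → Fin (suc m))
sigma {m} n≤k j i = sbar m j (inject≤ i n≤k)

InfoNo : ∀ {n k} → (Fin n → Fin k) → (Fin n → Fin k) → Set
InfoNo {n} σ y = ∀ (i : Fin n) → ¬ (σ i ≡ y i)

module Submission where

-- The k = suc m sequences σ̄^1, …, σ̄^k are the successive
-- cyclic rotations of (1, …, k), so at any fixed position x they take pairwise
-- distinct values: one rotation lowers every entry by one modulo k, hence
-- toℕ (σ̄^(j+1)_x) + j ≡ toℕ x (mod k), which determines j < k from the entry.
-- Consequently, for each position i ∈ [n] at most one shift j agrees with y at
-- i.  If every shift agreed with y somewhere, choosing such a position for
-- each shift would inject [k] into [n], impossible since n < k.  (Distinctness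
-- of the entries of y is not needed for this argument.)

open import Defs
open import Data.Nat using (ℕ; zero; suc; _<_; _≤_; _+_; _∸_; NonZero)
open import Data.Nat.Properties hiding (_≟_)
open import Data.Nat.DivMod using (_%_; m<n⇒m%n≡m; m≤n⇒[n∸m]%m≡n%m; %-distribˡ-+; m%n%n≡m%n; m%n<n; n%n≡0)
open import Data.Fin using (Fin; toℕ; zero; suc; fromℕ; inject₁; inject≤; _≟_)
open import Data.Fin.Properties using (toℕ-injective; toℕ<n; toℕ-fromℕ; toℕ-inject₁; injective⇒≤; any?; all?; ¬∀⟶∃¬)
open import Data.Product using (∃; _,_; proj₁; proj₂)
open import Data.Sum using (inj₁; inj₂)
open import Function.Definitions using (Injective)
open import Relation.Binary.PropositionalEquality
open import Relation.Nullary using (¬_; Dec; yes; no; ¬?; contradiction)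
open import Relation.Nullary.Decidable using (decidable-stable)

module Residues (k : ℕ) .{{_ : NonZero k}} where

  %-absorbˡ : ∀ a d → ((a % k) + d) % k ≡ (a + d) % k
  %-absorbˡ a d = begin
    ((a % k) + d) % k            ≡⟨ %-distribˡ-+ (a % k) d k ⟩
    ((a % k % k) + (d % k)) % k  ≡⟨ cong (λ r → (r + d % k) % k) (m%n%n≡m%n a k) ⟩
    ((a % k) + (d % k)) % k      ≡⟨ %-distribˡ-+ a d k ⟨
    (a + d) % k                  ∎
    where open ≡-Reasoning

  -- A residue t is fixed by adding d < k only if d = 0: without wrap-around
  -- t + d = t, and with wrap-around t + d ∸ k = t would force d = k.
  residue-fixed⇒0 : ∀ {t d} → t < k → d < k → (t + d) % k ≡ t → d ≡ 0
  residue-fixed⇒0 {t} {d} t<k d<k fixed with t + d <? k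
  ... | yes t+d<k = +-cancelˡ-≡ t d 0 (begin
        t + d        ≡⟨ m<n⇒m%n≡m t+d<k ⟨
        (t + d) % k  ≡⟨ fixed ⟩
        t            ≡⟨ +-identityʳ t ⟨
        t + 0        ∎)
    where open ≡-Reasoning
  ... | no t+d≮k = contradiction d<k (<-irrefl (+-cancelˡ-≡ t d k t+d≡t+k))
    where
      open ≡-Reasoning
      k≤t+d : k ≤ t + d
      k≤t+d = ≮⇒≥ t+d≮k
      t+d∸k<k : t + d ∸ k < k
      t+d∸k<k = +-cancelʳ-< k (t + d ∸ k) k
                  (subst (_< k + k) (sym (m∸n+n≡m k≤t+d)) (+-mono-< t<k d<k))
      wrapped : t + d ∸ k ≡ t
      wrapped = begin
        t + d ∸ k          ≡⟨ m<n⇒m%n≡m t+d∸k<k ⟨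
        (t + d ∸ k) % k    ≡⟨ m≤n⇒[n∸m]%m≡n%m k≤t+d ⟩
        (t + d) % k        ≡⟨ fixed ⟩
        t                  ∎
      t+d≡t+k : t + d ≡ t + k
      t+d≡t+k = begin
        t + d              ≡⟨ m∸n+n≡m k≤t+d ⟨
        (t + d ∸ k) + k    ≡⟨ cong (_+ k) wrapped ⟩
        t + k              ∎

  -- The case j ≤ j' of %-offset-injective: writing j' = j + d with d < k,
  -- the offset d fixes the residue (s + j) % k, so d = 0.
  %-offset-injective-≤ : ∀ s {j j'} → j ≤ j' → j' < k → (s + j) % k ≡ (s + j') % k → j ≡ j'
  %-offset-injective-≤ s {j} {j'} j≤j' j'<k same = begin
    j            ≡⟨ +-identityʳ j ⟨
    j + 0        ≡⟨ cong (j +_) d≡0 ⟨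
    j + d        ≡⟨ m+[n∸m]≡n j≤j' ⟩
    j'           ∎
    where
      open ≡-Reasoning
      d : ℕ
      d = j' ∸ j
      fixed : ((s + j) % k + d) % k ≡ (s + j) % k
      fixed = begin
        ((s + j) % k + d) % k  ≡⟨ %-absorbˡ (s + j) d ⟩
        (s + j + d) % k        ≡⟨ cong (_% k) (+-assoc s j d) ⟩
        (s + (j + d)) % k      ≡⟨ cong (λ e → (s + e) % k) (m+[n∸m]≡n j≤j') ⟩
        (s + j') % k           ≡⟨ same ⟨
        (s + j) % k            ∎
      d≡0 : d ≡ 0
      d≡0 = residue-fixed⇒0 (m%n<n (s + j) k) (≤-<-trans (m∸n≤m j' j) j'<k) fixed

  %-offset-injective : ∀ s {j j'} → j < k → j' < k → (s + j) % k ≡ (s + j') % k → j ≡ j'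
  %-offset-injective s {j} {j'} j<k j'<k same with ≤-total j j'
  ... | inj₁ j≤j' = %-offset-injective-≤ s j≤j' j'<k same
  ... | inj₂ j'≤j = sym (%-offset-injective-≤ s j'≤j j<k (sym same))

module Rotations (m : ℕ) where

  open Residues (suc m)

  -- Where one rotation to the right reads its entry: position 0 reads the
  -- last entry, position x+1 reads position x.
  rotate : Fin (suc m) → Fin (suc m)
  rotate zero    = fromℕ m
  rotate (suc x) = inject₁ x

  sbar-suc : ∀ j x → sbar m (suc j) x ≡ sbar m j (rotate x)
  sbar-suc j zero    = refl
  sbar-suc j (suc x) = refl

  rotate-residue : ∀ x → (toℕ (rotate x) + 1) % suc m ≡ toℕ x
  rotate-residue zero    rewrite toℕ-fromℕ m | +-comm m 1 = n%n≡0 (suc m)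
  rotate-residue (suc x) rewrite toℕ-inject₁ x | +-comm (toℕ x) 1 = m<n⇒m%n≡m (toℕ<n (suc x))

  sbar-residue : ∀ j x → (toℕ (sbar m j x) + j) % suc m ≡ toℕ x
  sbar-residue zero x rewrite +-identityʳ (toℕ x) = m<n⇒m%n≡m (toℕ<n x)
  sbar-residue (suc j) x = begin
    (toℕ (sbar m (suc j) x) + suc j) % suc m  ≡⟨ cong (λ e → (toℕ e + suc j) % suc m) (sbar-suc j x) ⟩
    (s + suc j) % suc m                       ≡⟨ cong (_% suc m) (trans (+-suc s j) (+-comm 1 (s + j))) ⟩
    ((s + j) + 1) % suc m                     ≡⟨ %-absorbˡ (s + j) 1 ⟨
    ((s + j) % suc m + 1) % suc m             ≡⟨ cong (λ r → (r + 1) % suc m) (sbar-residue j (rotate x)) ⟩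
    (toℕ (rotate x) + 1) % suc m              ≡⟨ rotate-residue x ⟩
    toℕ x                                     ∎
    where
      open ≡-Reasoning
      s : ℕ
      s = toℕ (sbar m j (rotate x))

  sbar-injective-in-shift : ∀ x {j j' : Fin (suc m)} →
                            sbar m (toℕ j) x ≡ sbar m (toℕ j') x → j ≡ j'
  sbar-injective-in-shift x {j} {j'} same = toℕ-injective
    (%-offset-injective (toℕ (sbar m (toℕ j) x)) (toℕ<n j) (toℕ<n j') (begin
      (toℕ (sbar m (toℕ j) x) + toℕ j) % suc m    ≡⟨ sbar-residue (toℕ j) x ⟩
      toℕ x                                       ≡⟨ sbar-residue (toℕ j') x ⟨
      (toℕ (sbar m (toℕ j') x) + toℕ j') % suc m  ≡⟨ cong (λ e → (toℕ e + toℕ j') % suc m) same ⟨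
      (toℕ (sbar m (toℕ j) x) + toℕ j') % suc m   ∎))
    where open ≡-Reasoning

-- Otherwise choosing a related position
-- for every candidate would inject Fin k into Fin n.
avoiding-candidate : ∀ {k n} (P : Fin k → Fin n → Set) → (∀ j i → Dec (P j i)) → n < k →
                     (∀ {j j' i} → P j i → P j' i → j ≡ j') →
                     ∃ λ j → ∀ i → ¬ P j i
avoiding-candidate {k} {n} P P? n<k unique with any? (λ j → all? (λ i → ¬? (P? j i)))
... | yes avoider = avoider
... | no  none    = contradiction (injective⇒≤ position-injective) (<⇒≱ n<k)
  where
    hit : ∀ j → ∃ (P j)
    hit j with ¬∀⟶∃¬ n (λ i → ¬ P j i) (λ i → ¬? (P? j i)) (λ avoids → none (j , avoids))
    ... | i , ¬¬Pji = i , decidable-stable (P? j i) ¬¬Pji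

    position : Fin k → Fin n
    position j = proj₁ (hit j)

    position-injective : Injective _≡_ _≡_ position
    position-injective {j} {j'} same =
      unique (proj₂ (hit j)) (subst (P j') (sym same) (proj₂ (hit j')))

lemma1 : (m n : ℕ) → (n<k : n < suc m) → (y : Fin n → Fin (suc m)) →
         Injective _≡_ _≡_ y →
         ∃ λ (j : Fin (suc m)) → InfoNo (sigma (<⇒≤ n<k) (toℕ j)) y
lemma1 m n n<k y _ = avoiding-candidate agrees agrees? n<k agrees-unique
  where
    open Rotations m

    agrees : Fin (suc m) → Fin n → Set
    agrees j i = sigma (<⇒≤ n<k) (toℕ j) i ≡ y i

    agrees? : ∀ j i → Dec (agrees j i)
    agrees? j i = sigma (<⇒≤ n<k) (toℕ j) i ≟ y i

    agrees-unique : ∀ {j j' i} → agrees j i → agrees j' i → j ≡ j'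
    agrees-unique {i = i} p p' = sbar-injective-in-shift (inject≤ i (<⇒≤ n<k)) (trans p (sym p'))
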